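{- Let $n\in\mathbb{N}$ be even. Then $\mathsf{g}(C_2\oplus C_{2n})\le 2n+2$.
   Context: For a finite abelian group $G$ (written additively), $\exp(G)$ denotes its exponent and $C_m$ a cyclic group of order $m$. The Harborth constant $\mathsf{g}(G)$ is the smallest $\ell\in\mathbb{N}$ such that every subset $S\subseteq G$ with $|S|\ge\ell$ contains a subset of exactly $\exp(G)$ elements whose sum is $0$. -}

module Defs where

open import Data.Nat using (ℕ; _≤_; _%_; NonZero)
open import Data.Nat.ListAction using (sum)
open import Data.Fin using (Fin; toℕ)
open import Data.Product using (_×_; proj₁; proj₂; ∃-syntax)
open import Data.List using (List; map; length)
open import Data.List.Relation.Unary.Unique.Propositional using (Unique)
open import Data.List.Relation.Binary.Sublist.Propositional using (_⊆_)
open import Relation.Binary.PropositionalEquality using (_≡_)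

-- The group C₂ ⊕ C_m, elements represented as pairs of residues
-- (a mod 2, b mod m), with componentwise addition modulo 2 and m.
C₂⊕C : ℕ → Set
C₂⊕C m = Fin 2 × Fin m

ZeroSum : (m : ℕ) → .{{NonZero m}} → List (C₂⊕C m) → Set
ZeroSum m T =
  (sum (map (λ x → toℕ (proj₁ x)) T) % 2 ≡ 0) ×
  (sum (map (λ x → toℕ (proj₂ x)) T) % m ≡ 0)

-- A subset S of C₂ ⊕ C_m is a duplicate-free list; its subsets are the
-- sublists of S.
HarborthProperty : (m : ℕ) → .{{NonZero m}} → (e ℓ : ℕ) → Set
HarborthProperty m e ℓ =
  ∀ (S : List (C₂⊕C m)) → Unique S → ℓ ≤ length S →
  ∃[ T ] (T ⊆ S × length T ≡ e × ZeroSum m T)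

-- g(C₂ ⊕ C_m) ≤ ℓ, where e = exp(C₂ ⊕ C_m): since g is the least ℓ' with
-- the Harborth property, g ≤ ℓ means some ℓ' ≤ ℓ has the property.
HarborthConstant≤ : (m : ℕ) → .{{NonZero m}} → (e ℓ : ℕ) → Set
HarborthConstant≤ m e ℓ = ∃[ ℓ' ] (ℓ' ≤ ℓ × HarborthProperty m e ℓ')

module Submission where

-- Let S ⊆ C₂ ⊕ C₂ₙ have 2n + 2 elements and sum σ = (σ₁, σ₂). If S contains x ≠ y with
-- x + y = σ, then S ∖ {x, y} has 2n elements and sum 0. The residues adding up to σ₂ are paired
-- by the involution b ↦ σ₂ − b of C₂ₙ.
-- If σ₁ = 1, x and y must have different first coordinates: sending (0, b) to b and (1, b) to
-- σ₂ − b maps 2n + 2 elements to C₂ₙ, and a collision can only occur across the two rows.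
-- If σ₁ = 0, the row with first coordinate 1 has even size, so, n + 1 being odd, some row has at
-- least n + 2 elements; the involution has at most n + 1 orbits, so two of them share an orbit.

open import Defs
open import Algebra.Definitions using (Selective)
open import Algebra.Properties.CommutativeSemigroup using (interchange)
open import Data.Nat using (ℕ; suc; _+_; _*_; _∸_; _≤_; _<_; _⊓_; _⊔_; _%_; _/_; _≤?_; _<?_; NonZero; s≤s)
open import Data.Nat.Properties hiding (_≟_)
open import Data.Nat.DivMod using (m≡m%n+[m/n]*n; m*n%n≡0; m<n⇒m%n≡m; [m+n]%n≡m%n; m%n<n)
open import Data.Nat.Divisibility using (_∣_; ∣m+n∣m⇒∣n; ∣1⇒≡1; m%n≡0⇒n∣m; m∣m*n)
open import Data.Nat.ListAction using (sum)
open import Data.Fin using (Fin; toℕ; fromℕ<; _≟_)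
open import Data.Fin.Patterns using (0F; 1F)
open import Data.Fin.Properties using (pigeonhole; toℕ-fromℕ<; toℕ-injective; toℕ<n)
open import Data.Product using (_×_; _,_; proj₁; proj₂; ∃-syntax)
open import Data.Product.Properties using (×-≡,≡→≡)
open import Data.Sum using (_⊎_; inj₁; inj₂; [_,_]′)
open import Data.List using (List; []; _∷_; map; length; lookup; take; filter)
open import Data.List.Properties using (length-removeAt′; length-take)
open import Data.List.Relation.Unary.Any using (here; there; _─_; index)
import Data.List.Relation.Unary.All as All
open import Data.List.Membership.Propositional using (_∈_)
open import Data.List.Membership.Propositional.Properties using (∈-lookup; ∈-filter⁻)
open import Data.List.Relation.Unary.Unique.Propositional using (Unique)
open import Data.List.Relation.Unary.Unique.Propositional.Properties using (filter⁺; take⁺)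
open import Data.List.Relation.Unary.AllPairs using (_∷_)
open import Data.List.Relation.Binary.Sublist.Propositional using (_⊆_; _∷_; _∷ʳ_; ⊆-refl; ⊆-trans)
open import Data.List.Relation.Binary.Sublist.Propositional.Properties using (take-⊆)
open import Function using (_∘_)
open import Relation.Binary.PropositionalEquality
open import Relation.Nullary using (yes; no; contradiction)

module _ {A : Set} where

  length-take-≤ : ∀ {n} {xs : List A} → n ≤ length xs → length (take n xs) ≡ n
  length-take-≤ {n} {xs} n≤len = trans (length-take n xs) (m≤n⇒m⊓n≡m n≤len)

  Unique⇒lookup-injective : ∀ {xs : List A} → Unique xs →
    ∀ i j → lookup xs i ≡ lookup xs j → i ≡ j
  Unique⇒lookup-injective (_  ∷ _) Fin.zero    Fin.zero    _  = refl
  Unique⇒lookup-injective (x≢ ∷ _) Fin.zero    (Fin.suc j) eq = contradiction eq (All.lookup x≢ (∈-lookup j))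
  Unique⇒lookup-injective (x≢ ∷ _) (Fin.suc i) Fin.zero    eq = contradiction (sym eq) (All.lookup x≢ (∈-lookup i))
  Unique⇒lookup-injective (_  ∷ u) (Fin.suc i) (Fin.suc j) eq = cong Fin.suc (Unique⇒lookup-injective u i j eq)

  unique-pigeonhole : ∀ {m} {xs : List A} → Unique xs → m < length xs →
    (f : A → ℕ) → (∀ x → f x < m) →
    ∃[ x ] ∃[ y ] (x ∈ xs × y ∈ xs × x ≢ y × f x ≡ f y)
  unique-pigeonhole {xs = xs} u m<len f f<m
    with i , j , i<j , eq ← pigeonhole m<len (λ i → fromℕ< (f<m (lookup xs i)))
    = lookup xs i , lookup xs j , ∈-lookup i , ∈-lookup j
    , (λ x≡y → <⇒≢ i<j (cong toℕ (Unique⇒lookup-injective u i j x≡y)))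
    , trans (sym (toℕ-fromℕ< _)) (trans (cong toℕ eq) (toℕ-fromℕ< _))

  ─-⊆ : ∀ {x} {xs : List A} (x∈xs : x ∈ xs) → (xs ─ x∈xs) ⊆ xs
  ─-⊆ {xs = y ∷ _} (here _)    = y ∷ʳ ⊆-refl
  ─-⊆             (there x∈xs) = refl ∷ ─-⊆ x∈xs

  ∈-─⁺ : ∀ {x y} {xs : List A} (x∈xs : x ∈ xs) → y ∈ xs → y ≢ x → y ∈ (xs ─ x∈xs)
  ∈-─⁺ (here refl)  (here refl)  y≢x = contradiction refl y≢x
  ∈-─⁺ (here _)     (there y∈xs) _   = y∈xs
  ∈-─⁺ (there _)    (here y≡)    _   = here y≡
  ∈-─⁺ (there x∈xs) (there y∈xs) y≢x = there (∈-─⁺ x∈xs y∈xs y≢x)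

  sum-map-─ : (f : A → ℕ) → ∀ {x} {xs : List A} (x∈xs : x ∈ xs) →
    sum (map f xs) ≡ f x + sum (map f (xs ─ x∈xs))
  sum-map-─ f (here refl) = refl
  sum-map-─ f {x} {y ∷ xs} (there x∈xs) = begin
    f y + sum (map f xs)                       ≡⟨ cong (f y +_) (sum-map-─ f x∈xs) ⟩
    f y + (f x + sum (map f (xs ─ x∈xs)))      ≡⟨ sym (+-assoc (f y) (f x) _) ⟩
    f y + f x + sum (map f (xs ─ x∈xs))        ≡⟨ cong (_+ sum (map f (xs ─ x∈xs))) (+-comm (f y) (f x)) ⟩
    f x + f y + sum (map f (xs ─ x∈xs))        ≡⟨ +-assoc (f x) (f y) _ ⟩
    f x + (f y + sum (map f (xs ─ x∈xs)))      ∎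
    where open ≡-Reasoning

  remove-pair : ∀ {x y} {xs : List A} → x ∈ xs → y ∈ xs → x ≢ y →
    ∃[ ys ] (ys ⊆ xs × length xs ≡ 2 + length ys ×
             ∀ f → sum (map f xs) ≡ f x + f y + sum (map f ys))
  remove-pair {x} {y} {xs} x∈xs y∈xs x≢y =
    ((xs ─ x∈xs) ─ y∈xs′) , ⊆-trans (─-⊆ y∈xs′) (─-⊆ x∈xs) ,
    trans (length-removeAt′ xs (index x∈xs)) (cong suc (length-removeAt′ (xs ─ x∈xs) (index y∈xs′))) ,
    λ f → trans (sum-map-─ f x∈xs) (trans (cong (f x +_) (sum-map-─ f y∈xs′)) (sym (+-assoc (f x) (f y) _)))
    where
    y∈xs′ : y ∈ (xs ─ x∈xs)
    y∈xs′ = ∈-─⁺ x∈xs y∈xs (x≢y ∘ sym)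

%-cancelˡ-+ : ∀ a t m .{{_ : NonZero m}} → (a + t) % m ≡ a % m → t % m ≡ 0
%-cancelˡ-+ a t m eq = trans (cong (_% m) t≡) (m*n%n≡0 ((a + t) / m ∸ a / m) m)
  where
  open ≡-Reasoning
  t≡ : t ≡ ((a + t) / m ∸ a / m) * m
  t≡ = begin
    t                                                  ≡⟨ sym (m+n∸m≡n a t) ⟩
    (a + t) ∸ a                                        ≡⟨ cong₂ _∸_ (m≡m%n+[m/n]*n (a + t) m) (m≡m%n+[m/n]*n a m) ⟩
    ((a + t) % m + (a + t) / m * m) ∸ (a % m + a / m * m) ≡⟨ cong (λ ρ → (ρ + (a + t) / m * m) ∸ (a % m + a / m * m)) eq ⟩
    (a % m + (a + t) / m * m) ∸ (a % m + a / m * m)    ≡⟨ [m+n]∸[m+o]≡n∸o (a % m) _ _ ⟩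
    (a + t) / m * m ∸ a / m * m                        ≡⟨ sym (*-distribʳ-∸ m ((a + t) / m) (a / m)) ⟩
    ((a + t) / m ∸ a / m) * m                          ∎

selective-orbit : ∀ {A : Set} {_∙_ : A → A → A} → Selective _≡_ _∙_ →
  (p : A → A) {a b : A} → p (p a) ≡ a → p (p b) ≡ b →
  a ∙ p a ≡ b ∙ p b → b ≡ a ⊎ b ≡ p a
selective-orbit {_∙_ = _∙_} sel p {a} {b} ppa ppb eq with sel a (p a) | sel b (p b)
... | inj₁ ∙≡a | inj₁ ∙≡b = inj₁ (trans (sym ∙≡b) (trans (sym eq) ∙≡a))
... | inj₁ ∙≡a | inj₂ ∙≡pb = inj₂ (trans (sym ppb) (cong p (trans (sym ∙≡pb) (trans (sym eq) ∙≡a))))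
... | inj₂ ∙≡pa | inj₁ ∙≡b = inj₂ (trans (sym ∙≡b) (trans (sym eq) ∙≡pa))
... | inj₂ ∙≡pa | inj₂ ∙≡pb = inj₁ (trans (sym ppb) (trans (cong p (trans (sym ∙≡pb) (trans (sym eq) ∙≡pa))) ppa))

unbalanced-even-split : ∀ {n a b} → 2 ∣ n → 2 ∣ a → a + b ≡ suc n + suc n → suc n < a ⊎ suc n < b
unbalanced-even-split {n} {a} {b} 2∣n 2∣a a+b≡ with suc n <? a | suc n <? b
... | yes n<a | _     = inj₁ n<a
... | no _    | yes n<b = inj₂ n<b
... | no n≮a  | no n≮b = contradiction (∣1⇒≡1 2∣1) λ ()
  where
  n≤a : suc n ≤ a
  n≤a = +-cancelʳ-≤ b (suc n) a (≤-trans (+-monoʳ-≤ (suc n) (≮⇒≥ n≮b)) (≤-reflexive (sym a+b≡)))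
  2∣1 : 2 ∣ 1
  2∣1 = ∣m+n∣m⇒∣n (subst (2 ∣_) (trans (≤-antisym (≮⇒≥ n≮a) n≤a) (+-comm 1 n)) 2∣a) 2∣n

m%2≡0⊎m%2≡1 : ∀ m → m % 2 ≡ 0 ⊎ m % 2 ≡ 1
m%2≡0⊎m%2≡1 m with m % 2 | m%n<n m 2
... | 0           | _ = inj₁ refl
... | 1           | _ = inj₂ refl
... | suc (suc _) | s≤s (s≤s ())

[m+m]%2≡0 : ∀ m → (m + m) % 2 ≡ 0
[m+m]%2≡0 m = trans (cong (_% 2) (sym (trans (*-comm m 2) (cong (m +_) (+-identityʳ m))))) (m*n%n≡0 m 2)

m+m≤n+n⇒m≤n : ∀ {m n} → m + m ≤ n + n → m ≤ n
m+m≤n+n⇒m≤n m+m≤n+n = ≮⇒≥ (λ n<m → <⇒≱ (+-mono-< n<m n<m) m+m≤n+n)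

m+m<n+n⇒m<n : ∀ {m n} → m + m < n + n → m < n
m+m<n+n⇒m<n m+m<n+n = ≰⇒> (λ n≤m → <⇒≱ m+m<n+n (+-mono-≤ n≤m n≤m))

module Partner (M r : ℕ) (r<M : r < M) where

  -- For b < M, partner b is the residue of r − b modulo M.
  partner : ℕ → ℕ
  partner b with b ≤? r
  ... | yes _ = r ∸ b
  ... | no  _ = r + M ∸ b

  partner-low : ∀ {b} → b ≤ r → partner b ≡ r ∸ b
  partner-low {b} b≤r with b ≤? r
  ... | yes _   = refl
  ... | no  b≰r = contradiction b≤r b≰r

  partner-high : ∀ {b} → r < b → partner b ≡ r + M ∸ b
  partner-high {b} r<b with b ≤? r
  ... | yes b≤r = contradiction b≤r (<⇒≱ r<b)
  ... | no  _   = refl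

  +-partner-low : ∀ {b} → b ≤ r → b + partner b ≡ r
  +-partner-low b≤r rewrite partner-low b≤r = m+[n∸m]≡n b≤r

  +-partner-high : ∀ {b} → r < b → b < M → b + partner b ≡ r + M
  +-partner-high r<b b<M rewrite partner-high r<b = m+[n∸m]≡n (≤-trans (<⇒≤ b<M) (m≤n+m M r))

  partner-low-≤ : ∀ {b} → b ≤ r → partner b ≤ r
  partner-low-≤ {b} b≤r rewrite partner-low b≤r = m∸n≤m r b

  partner-high-> : ∀ {b} → r < b → b < M → r < partner b
  partner-high-> {b} r<b b<M = +-cancelˡ-< b r (partner b) (begin-strict
    b + r        <⟨ +-monoˡ-< r b<M ⟩
    M + r        ≡⟨ +-comm M r ⟩
    r + M        ≡⟨ sym (+-partner-high r<b b<M) ⟩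
    b + partner b ∎)
    where open ≤-Reasoning

  partner-< : ∀ {b} → b < M → partner b < M
  partner-< {b} b<M with ≤-<-connex b r
  ... | inj₁ b≤r = ≤-<-trans (partner-low-≤ b≤r) r<M
  ... | inj₂ r<b = begin-strict
    partner b     ≡⟨ partner-high r<b ⟩
    r + M ∸ b     <⟨ ∸-monoʳ-< r<b (≤-trans (<⇒≤ b<M) (m≤n+m M r)) ⟩
    r + M ∸ r     ≡⟨ m+n∸m≡n r M ⟩
    M             ∎
    where open ≤-Reasoning

  partner-involutive : ∀ {b} → b < M → partner (partner b) ≡ b
  partner-involutive {b} b<M with ≤-<-connex b r
  ... | inj₁ b≤r = begin
    partner (partner b) ≡⟨ partner-low (partner-low-≤ b≤r) ⟩
    r ∸ partner b       ≡⟨ cong (r ∸_) (partner-low b≤r) ⟩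
    r ∸ (r ∸ b)         ≡⟨ m∸[m∸n]≡n b≤r ⟩
    b                   ∎
    where open ≡-Reasoning
  ... | inj₂ r<b = begin
    partner (partner b) ≡⟨ partner-high (partner-high-> r<b b<M) ⟩
    r + M ∸ partner b   ≡⟨ cong (r + M ∸_) (partner-high r<b) ⟩
    r + M ∸ (r + M ∸ b) ≡⟨ m∸[m∸n]≡n (≤-trans (<⇒≤ b<M) (m≤n+m M r)) ⟩
    b                   ∎
    where open ≡-Reasoning

  partner-injective : ∀ {b b′} → b < M → b′ < M → partner b ≡ partner b′ → b ≡ b′
  partner-injective b<M b′<M eq =
    trans (sym (partner-involutive b<M)) (trans (cong partner eq) (partner-involutive b′<M))

  +-partner-% : ∀ {b} .{{_ : NonZero M}} → b < M → (b + partner b) % M ≡ r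
  +-partner-% {b} b<M with ≤-<-connex b r
  ... | inj₁ b≤r = trans (cong (_% M) (+-partner-low b≤r)) (m<n⇒m%n≡m r<M)
  ... | inj₂ r<b = trans (cong (_% M) (+-partner-high r<b b<M))
                         (trans ([m+n]%n≡m%n r M) (m<n⇒m%n≡m r<M))

module Classes (n r : ℕ) {M : ℕ} (M≡n+n : M ≡ n + n) (r<M : r < M) where
  open Partner M r r<M

  -- An index in [0, n] of the orbit {b, partner b}: orbits inside [0, r] are indexed by their
  -- minimum (at most r / 2), orbits inside (r, M) by 1 + (maximum − n) (more than r / 2).
  class : ℕ → ℕ
  class b with ≤-<-connex b r
  ... | inj₁ _ = b ⊓ partner b
  ... | inj₂ _ = suc ((b ⊔ partner b) ∸ n)

  class-low : ∀ {b} → b ≤ r → class b ≡ b ⊓ partner b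
  class-low {b} b≤r with ≤-<-connex b r
  ... | inj₁ _   = refl
  ... | inj₂ r<b = contradiction b≤r (<⇒≱ r<b)

  class-high : ∀ {b} → r < b → class b ≡ suc ((b ⊔ partner b) ∸ n)
  class-high {b} r<b with ≤-<-connex b r
  ... | inj₁ b≤r = contradiction b≤r (<⇒≱ r<b)
  ... | inj₂ _   = refl

  class-low-double : ∀ {b} → b ≤ r → class b + class b ≤ r
  class-low-double {b} b≤r rewrite class-low b≤r =
    ≤-trans (+-mono-≤ (m⊓n≤m b (partner b)) (m⊓n≤n b (partner b))) (≤-reflexive (+-partner-low b≤r))

  private
    r+M≤max+max : ∀ {b} → r < b → b < M → r + M ≤ (b ⊔ partner b) + (b ⊔ partner b)
    r+M≤max+max {b} r<b b<M = ≤-trans (≤-reflexive (sym (+-partner-high r<b b<M)))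
      (+-mono-≤ (m≤m⊔n b (partner b)) (m≤n⊔m b (partner b)))

    n≤max : ∀ {b} → r < b → b < M → n ≤ b ⊔ partner b
    n≤max {b} r<b b<M = m+m≤n+n⇒m≤n (begin
      n + n                          ≡⟨ sym M≡n+n ⟩
      M                              ≤⟨ m≤n+m M r ⟩
      r + M                          ≤⟨ r+M≤max+max r<b b<M ⟩
      (b ⊔ partner b) + (b ⊔ partner b)  ∎)
      where open ≤-Reasoning

  class-high-double : ∀ {b} → r < b → b < M → r < class b + class b
  class-high-double {b} r<b b<M rewrite class-high r<b =
    s≤s (≤-trans r≤d+d (+-monoʳ-≤ d (n≤1+n d)))
    where
    d = (b ⊔ partner b) ∸ n
    r≤d+d : r ≤ d + d
    r≤d+d = +-cancelʳ-≤ (n + n) r (d + d) (begin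
      r + (n + n)              ≡⟨ cong (r +_) (sym M≡n+n) ⟩
      r + M                    ≤⟨ r+M≤max+max r<b b<M ⟩
      (b ⊔ partner b) + (b ⊔ partner b) ≡⟨ sym (cong₂ _+_ (m∸n+n≡m (n≤max r<b b<M)) (m∸n+n≡m (n≤max r<b b<M))) ⟩
      (d + n) + (d + n)        ≡⟨ interchange +-commutativeSemigroup d n d n ⟩
      (d + d) + (n + n)        ∎)
      where open ≤-Reasoning

  class-high-≤ : ∀ {b} → r < b → b < M → class b ≤ n
  class-high-≤ {b} r<b b<M rewrite class-high r<b = begin-strict
    (b ⊔ partner b) ∸ n   <⟨ ∸-monoˡ-< (⊔-lub b<M (partner-< b<M)) (n≤max r<b b<M) ⟩
    M ∸ n               ≡⟨ cong (_∸ n) M≡n+n ⟩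
    n + n ∸ n           ≡⟨ m+n∸n≡m n n ⟩
    n                   ∎
    where open ≤-Reasoning

  class-< : ∀ {b} → b < M → class b < suc n
  class-< {b} b<M = [ low , high ]′ (≤-<-connex b r)
    where
    low : b ≤ r → class b < suc n
    low b≤r = m<n⇒m<1+n (m+m<n+n⇒m<n (≤-<-trans (class-low-double b≤r) (<-≤-trans r<M (≤-reflexive M≡n+n))))
    high : r < b → class b < suc n
    high r<b = s≤s (class-high-≤ r<b b<M)

  class-orbit : ∀ {b b′} → b < M → b′ < M → class b ≡ class b′ → b′ ≡ b ⊎ b′ ≡ partner b
  class-orbit {b} {b′} b<M b′<M eq = cases (≤-<-connex b r) (≤-<-connex b′ r)
    where
    cases : b ≤ r ⊎ r < b → b′ ≤ r ⊎ r < b′ → b′ ≡ b ⊎ b′ ≡ partner b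
    cases (inj₁ b≤r) (inj₁ b′≤r) =
      selective-orbit ⊓-sel partner (partner-involutive b<M) (partner-involutive b′<M)
        (trans (sym (class-low b≤r)) (trans eq (class-low b′≤r)))
    cases (inj₂ r<b) (inj₂ r<b′) =
      selective-orbit ⊔-sel partner (partner-involutive b<M) (partner-involutive b′<M)
        (∸-cancelʳ-≡ (n≤max r<b b<M) (n≤max r<b′ b′<M)
          (suc-injective (trans (sym (class-high r<b)) (trans eq (class-high r<b′)))))
    cases (inj₁ b≤r) (inj₂ r<b′) = contradiction (class-high-double r<b′ b′<M)
      (≤⇒≯ (subst (λ c → c + c ≤ r) eq (class-low-double b≤r)))
    cases (inj₂ r<b) (inj₁ b′≤r) = contradiction (class-high-double r<b b<M)
      (≤⇒≯ (subst (λ c → c + c ≤ r) (sym eq) (class-low-double b′≤r)))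

module _ {M : ℕ} where

  first second : C₂⊕C M → ℕ
  first  x = toℕ (proj₁ x)
  second x = toℕ (proj₂ x)

  σ₁ σ₂ : List (C₂⊕C M) → ℕ
  σ₁ S = sum (map first S)
  σ₂ S = sum (map second S)

  row : Fin 2 → List (C₂⊕C M) → List (C₂⊕C M)
  row a = filter ((_≟ a) ∘ proj₁)

  σ₁≡length-row₁ : ∀ S → σ₁ S ≡ length (row 1F S)
  σ₁≡length-row₁ []             = refl
  σ₁≡length-row₁ ((0F , _) ∷ S) = σ₁≡length-row₁ S
  σ₁≡length-row₁ ((1F , _) ∷ S) = cong suc (σ₁≡length-row₁ S)

  length-rows : ∀ S → length (row 1F S) + length (row 0F S) ≡ length S
  length-rows []             = refl
  length-rows ((0F , _) ∷ S) = trans (+-suc _ _) (cong suc (length-rows S))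
  length-rows ((1F , _) ∷ S) = cong suc (length-rows S)

module _ {M : ℕ} .{{_ : NonZero M}} where

  PairSum≡σ : List (C₂⊕C M) → C₂⊕C M → C₂⊕C M → Set
  PairSum≡σ S x y = (first x + first y) % 2 ≡ σ₁ S % 2 × (second x + second y) % M ≡ σ₂ S % M

  σPair : List (C₂⊕C M) → Set
  σPair S = ∃[ x ] ∃[ y ] (x ∈ S × y ∈ S × x ≢ y × PairSum≡σ S x y)

  σPair-swap : ∀ {S x y} → x ∈ S → y ∈ S → x ≢ y → PairSum≡σ S x y → σPair S
  σPair-swap {x = x} {y} x∈S y∈S x≢y (sum₁ , sum₂) =
    y , x , y∈S , x∈S , x≢y ∘ sym ,
    trans (cong (_% 2) (+-comm (first y) (first x))) sum₁ ,
    trans (cong (_% M) (+-comm (second y) (second x))) sum₂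

  σPair⇒zero-sum-complement : ∀ {S} → σPair S →
    ∃[ T ] (T ⊆ S × length S ≡ 2 + length T × ZeroSum M T)
  σPair⇒zero-sum-complement {S} (x , y , x∈S , y∈S , x≢y , sum₁ , sum₂)
    with T , T⊆S , len , sum≡ ← remove-pair x∈S y∈S x≢y
    = T , T⊆S , len ,
      %-cancelˡ-+ (first x + first y) (σ₁ T) 2 (trans (cong (_% 2) (sym (sum≡ first))) (sym sum₁)) ,
      %-cancelˡ-+ (second x + second y) (σ₂ T) M (trans (cong (_% M) (sym (sum≡ second))) (sym sum₂))

module _ (n : ℕ) {M : ℕ} .{{_ : NonZero M}} (M≡n+n : M ≡ n + n) where

  module _ (S : List (C₂⊕C M)) where
    open Partner M (σ₂ S % M) (m%n<n (σ₂ S) M)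
    open Classes n (σ₂ S % M) M≡n+n (m%n<n (σ₂ S) M)

    crossKey : C₂⊕C M → ℕ
    crossKey (0F , b) = toℕ b
    crossKey (1F , b) = partner (toℕ b)

    crossKey-< : ∀ x → crossKey x < M
    crossKey-< (0F , b) = toℕ<n b
    crossKey-< (1F , b) = partner-< (toℕ<n b)

    crossSum : σ₁ S % 2 ≡ 1 → ∀ {b b′} → toℕ b ≡ partner (toℕ b′) → PairSum≡σ S (0F , b) (1F , b′)
    crossSum odd {b′ = b′} eq =
      sym odd , trans (cong (_% M) (trans (cong (_+ toℕ b′) eq) (+-comm _ (toℕ b′)))) (+-partner-% (toℕ<n b′))

    crossPair : σ₁ S % 2 ≡ 1 → Unique S → M < length S → σPair S
    crossPair odd u M<len with unique-pigeonhole u M<len crossKey crossKey-<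
    ... | (0F , b) , (0F , b′) , _ , _ , x≢y , eq = contradiction (cong (0F ,_) (toℕ-injective eq)) x≢y
    ... | (1F , b) , (1F , b′) , _ , _ , x≢y , eq =
      contradiction (cong (1F ,_) (toℕ-injective (partner-injective (toℕ<n b) (toℕ<n b′) eq))) x≢y
    ... | (0F , b) , (1F , b′) , x∈S , y∈S , x≢y , eq = _ , _ , x∈S , y∈S , x≢y , crossSum odd eq
    ... | (1F , b) , (0F , b′) , x∈S , y∈S , x≢y , eq = σPair-swap y∈S x∈S (x≢y ∘ sym) (crossSum odd (sym eq))

    sameRowPair : σ₁ S % 2 ≡ 0 → ∀ {x y} → x ∈ S → y ∈ S → x ≢ y → proj₁ x ≡ proj₁ y →
      class (second x) ≡ class (second y) → σPair S
    sameRowPair even {x} {y} x∈S y∈S x≢y same-row eq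
      with class-orbit (toℕ<n (proj₂ x)) (toℕ<n (proj₂ y)) eq
    ... | inj₁ y≡x = contradiction (×-≡,≡→≡ (same-row , toℕ-injective (sym y≡x))) x≢y
    ... | inj₂ y≡x* = x , y , x∈S , y∈S , x≢y ,
      trans (cong (λ i → (first x + toℕ i) % 2) (sym same-row)) (trans ([m+m]%2≡0 (first x)) (sym even)) ,
      trans (cong (λ c → (second x + c) % M) y≡x*) (+-partner-% (toℕ<n (proj₂ x)))

    rowPair : (a : Fin 2) → σ₁ S % 2 ≡ 0 → Unique S → suc n < length (row a S) → σPair S
    rowPair a even u big =
      let x , y , x∈row , y∈row , x≢y , eq =
            unique-pigeonhole (filter⁺ _ u) big (class ∘ second) (class-< ∘ toℕ<n ∘ proj₂)
          x∈S , x≡a = ∈-filter⁻ ((_≟ a) ∘ proj₁) {xs = S} x∈row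
          y∈S , y≡a = ∈-filter⁻ ((_≟ a) ∘ proj₁) {xs = S} y∈row
      in sameRowPair even x∈S y∈S x≢y (trans x≡a (sym y≡a)) eq

    evenPair : 2 ∣ n → σ₁ S % 2 ≡ 0 → Unique S → length S ≡ M + 2 → σPair S
    evenPair n-even even u len =
      [ rowPair 1F even u , rowPair 0F even u ]′ (unbalanced-even-split n-even row₁-even rows≡)
      where
      row₁-even : 2 ∣ length (row 1F S)
      row₁-even = m%n≡0⇒n∣m _ 2 (trans (cong (_% 2) (sym (σ₁≡length-row₁ S))) even)
      rows≡ : length (row 1F S) + length (row 0F S) ≡ suc n + suc n
      rows≡ = trans (length-rows S) (trans len (trans (cong (_+ 2) M≡n+n)
                (trans (+-comm (n + n) 2) (sym (cong suc (+-suc n n))))))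

  σPair-exists : 2 ∣ n → ∀ {S : List (C₂⊕C M)} → Unique S → length S ≡ M + 2 → σPair S
  σPair-exists n-even {S} u len =
    [ (λ even → evenPair S n-even even u len) , (λ odd → crossPair S odd u M<len) ]′ (m%2≡0⊎m%2≡1 (σ₁ S))
    where
    M<len : M < length S
    M<len = ≤-trans (n≤1+n (suc M)) (≤-reflexive (trans (+-comm 2 M) (sym len)))

  harborth-property : 2 ∣ n → HarborthProperty M M (M + 2)
  harborth-property n-even S u M+2≤len =
    let T , T⊆S′ , len≡2+T , zero-sum =
          σPair⇒zero-sum-complement (σPair-exists n-even (take⁺ (M + 2) u) (length-take-≤ M+2≤len))
    in T , ⊆-trans T⊆S′ (take-⊆ (M + 2) S) ,
       +-cancelˡ-≡ 2 _ _ (trans (sym len≡2+T) (trans (length-take-≤ M+2≤len) (+-comm M 2))) , zero-sum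

proposition5p3 : (k : ℕ) →
    let n = 2 * suc k in
    HarborthConstant≤ (2 * n) (2 * n) (2 * n + 2)
proposition5p3 k = 2 * n + 2 , ≤-refl , harborth-property n (cong (n +_) (+-identityʳ n)) (m∣m*n (suc k))
  where
  n = 2 * suc k
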